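{- Let $\tau=\{\tau_1,\dots,\tau_t\}$ be a set of patterns and let $\tau^{ -1}=\{\tau_1^{ -1},\dots,\tau_t^{ -1}\}$. Then for all nonnegative integers $d,c,r$, $|\mathcal S_{d,c,r}(\tau)|=|\mathcal S_{d,r,c}(\tau^{ -1})|$.
   Context: The permutation matrix of $\sigma\in\mathcal S_n$ is the $n\times n$ $0$-$1$ matrix with a $1$ in position $(i,\sigma(i))$. A partial permutation is a rectangular $0$-$1$ matrix with at most one $1$ ("dot") in each row and column. $\mathcal S_{d,c,r}$ is the set of partial permutations with $d$ dots, $r$ empty rows and $c$ empty columns, so they have size $(d+r)\times(d+c)$. Matrices with zero rows or columns are allowed and distinguished by their dimensions. A permutation $\sigma\in\mathcal S_{d+c+r}$ extends $\rho\in\mathcal S_{d,c,r}$ if $\rho$ is the upper-left $(d+r)\times(d+c)$ submatrix of the permutation matrix of $\sigma$. $\sigma$ contains a pattern $\pi\in\mathcal S_m$ if the permutation matrix of $\pi$ is a submatrix of that of $\sigma$. $\rho$ extendably avoids the set $\tau$ if some extension of $\rho$ avoids every $\tau_i$. $\mathcal S_{d,c,r}(\tau)$ is the set of such $\rho\in\mathcal S_{d,c,r}$. -}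

module Defs where

open import Data.Nat using (ℕ; zero; suc; _+_; _≤_)
open import Data.Nat.Properties using (+-monoˡ-≤; +-monoʳ-≤; m≤m+n; ≤-refl)
open import Data.Bool using (Bool; true; false)
open import Data.Fin using (Fin; zero; suc; inject≤; _<_; _≟_)
open import Data.Fin.Permutation using (Permutation′; _⟨$⟩ʳ_; flip)
open import Data.List using (List; map)
open import Data.List.Relation.Unary.All using (All)
open import Data.Product using (Σ; ∃; _×_; _,_)
open import Relation.Binary.PropositionalEquality using (_≡_)
open import Relation.Nullary using (¬_)
open import Relation.Nullary.Decidable using (⌊_⌋)

Mat : ℕ → ℕ → Set
Mat m n = Fin m → Fin n → Bool

countTrue : ∀ n → (Fin n → Bool) → ℕ
countTrue zero    v = 0
countTrue (suc n) v with v zero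
... | true  = suc (countTrue n (λ i → v (suc i)))
... | false = countTrue n (λ i → v (suc i))

dots : ∀ m n → Mat m n → ℕ
dots zero    n M = 0
dots (suc m) n M = countTrue n (M zero) + dots m n (λ i → M (suc i))

IsPartialPerm : ∀ {m n} → Mat m n → Set
IsPartialPerm {m} {n} M =
  (∀ i j j' → M i j ≡ true → M i j' ≡ true → j ≡ j') ×
  (∀ i i' j → M i j ≡ true → M i' j ≡ true → i ≡ i')

-- S_{d,c,r}: partial permutations of size (d+r) × (d+c) with d dots
-- (then there are automatically r empty rows and c empty columns)
InS : ∀ d c r → Mat (d + r) (d + c) → Set
InS d c r M = IsPartialPerm M × dots (d + r) (d + c) M ≡ d

permMat : ∀ {n} → Permutation′ n → Mat n n
permMat σ i j = ⌊ (σ ⟨$⟩ʳ i) ≟ j ⌋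

Pattern : Set
Pattern = Σ ℕ Permutation′

inversePattern : Pattern → Pattern
inversePattern (m , π) = m , flip π

inversePatterns : List Pattern → List Pattern
inversePatterns = map inversePattern

Contains : ∀ {N} → Permutation′ N → Pattern → Set
Contains {N} σ (m , π) =
  Σ (Fin m → Fin N) λ f → Σ (Fin m → Fin N) λ g →
    (∀ i j → i < j → f i < f j) ×
    (∀ i j → i < j → g i < g j) ×
    (∀ i j → permMat σ (f i) (g j) ≡ permMat π i j)

Avoids : ∀ {N} → Permutation′ N → Pattern → Set
Avoids σ p = ¬ Contains σ p

rows≤ : ∀ d c r → d + r ≤ d + c + r
rows≤ d c r = +-monoˡ-≤ r (m≤m+n d c)

cols≤ : ∀ d c r → d + c ≤ d + c + r
cols≤ d c r = m≤m+n (d + c) r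

Extends : ∀ d c r → Permutation′ (d + c + r) → Mat (d + r) (d + c) → Set
Extends d c r σ ρ =
  ∀ i j → permMat σ (inject≤ i (rows≤ d c r)) (inject≤ j (cols≤ d c r)) ≡ ρ i j

InSAvoid : ∀ d c r → List Pattern → Mat (d + r) (d + c) → Set
InSAvoid d c r τ ρ =
  InS d c r ρ ×
  ∃ λ (σ : Permutation′ (d + c + r)) → Extends d c r σ ρ × All (Avoids σ) τ

_≈ₘ_ : ∀ {m n} → Mat m n → Mat m n → Set
M ≈ₘ N = ∀ i j → M i j ≡ N i j

-- |P| = |Q| for sets of matrices P, Q (up to entrywise equality):
-- there is a bijection between them
SameCard : ∀ {m n m' n'} → (Mat m n → Set) → (Mat m' n' → Set) → Set
SameCard {m} {n} {m'} {n'} P Q =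
  Σ (Mat m n → Mat m' n') λ f → Σ (Mat m' n' → Mat m n) λ g →
    (∀ M → P M → Q (f M)) ×
    (∀ N → Q N → P (g N)) ×
    (∀ M → P M → g (f M) ≈ₘ M) ×
    (∀ N → Q N → f (g N) ≈ₘ N)

-- Transposition is the bijection. The transpose of a partial permutation is a partial
-- permutation with the same number of dots, with empty rows and empty columns exchanged.
-- The matrix of σ⁻¹ is the transpose of that of σ, so if σ extends ρ then σ⁻¹ extends ρᵀ,
-- and σ⁻¹ contains π⁻¹ whenever σ contains π; hence an extension avoiding τ yields one
-- avoiding τ⁻¹. Transposition being an involution, this gives the bijection.
module Submission where

open import Defs
open import Data.Nat using (ℕ)
open import Data.List using (List)

import Algebra.Properties.CommutativeMonoid.Sum as Sum
open import Data.Bool using (Bool; true; false)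
open import Data.Fin using (Fin; zero; suc; toℕ; inject≤; _≟_)
open import Data.Fin.Properties using (toℕ-injective; toℕ-inject≤)
open import Data.Fin.Permutation using (Permutation′; flip)
open import Data.List.Relation.Unary.All as All using (All)
open import Data.List.Relation.Unary.All.Properties using (map⁺; map⁻)
open import Data.Nat using (zero; suc; _+_; _≤_)
open import Data.Nat.Properties using (+-0-commutativeMonoid; +-assoc; +-comm)
open import Data.Product using (_,_)
open import Function using (_∘′_)
open import Function.Bundles using (Inverse; mk⇔)
open import Relation.Binary.PropositionalEquality
open import Relation.Nullary.Decidable using (⌊_⌋; isYes≗does; does-⇔)

open Sum +-0-commutativeMonoid using (∑-comm; sum-syntax)

transpose : ∀ {m n} → Mat m n → Mat n m
transpose M j i = M i j

indicator : Bool → ℕ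
indicator true  = 1
indicator false = 0

countTrue≡∑ : ∀ n (v : Fin n → Bool) → countTrue n v ≡ ∑[ j < n ] indicator (v j)
countTrue≡∑ zero    v = refl
countTrue≡∑ (suc n) v with v zero
... | true  = cong suc (countTrue≡∑ n (λ j → v (suc j)))
... | false = countTrue≡∑ n (λ j → v (suc j))

dots≡∑∑ : ∀ m n (M : Mat m n) → dots m n M ≡ ∑[ i < m ] ∑[ j < n ] indicator (M i j)
dots≡∑∑ zero    n M = refl
dots≡∑∑ (suc m) n M =
  cong₂ _+_ (countTrue≡∑ n (M zero)) (dots≡∑∑ m n (λ i → M (suc i)))

dots-transpose : ∀ m n (M : Mat m n) → dots n m (transpose M) ≡ dots m n M
dots-transpose m n M = begin
  dots n m (transpose M)                   ≡⟨ dots≡∑∑ n m (transpose M) ⟩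
  ∑[ j < n ] ∑[ i < m ] indicator (M i j)  ≡⟨ ∑-comm (λ j i → indicator (M i j)) ⟩
  ∑[ i < m ] ∑[ j < n ] indicator (M i j)  ≡⟨ dots≡∑∑ m n M ⟨
  dots m n M                               ∎
  where open ≡-Reasoning

IsPartialPerm-transpose : ∀ {m n} {M : Mat m n} → IsPartialPerm M → IsPartialPerm (transpose M)
IsPartialPerm-transpose (rowsUnique , colsUnique) =
  (λ j i i' → colsUnique i i' j) , (λ j j' i → rowsUnique i j j')

InS-transpose : ∀ d c r {M : Mat (d + r) (d + c)} → InS d c r M → InS d r c (transpose M)
InS-transpose d c r {M} (partial , dotCount) =
  IsPartialPerm-transpose partial , trans (dots-transpose (d + r) (d + c) M) dotCount

⌊≟⌋-⇔ : ∀ {n n'} {i j : Fin n} {i' j' : Fin n'} →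
  (i ≡ j → i' ≡ j') → (i' ≡ j' → i ≡ j) → ⌊ i ≟ j ⌋ ≡ ⌊ i' ≟ j' ⌋
⌊≟⌋-⇔ {i = i} {j} {i'} {j'} to from = trans (isYes≗does (i ≟ j))
  (trans (does-⇔ (mk⇔ to from) (i ≟ j) (i' ≟ j')) (sym (isYes≗does (i' ≟ j'))))

permMat-flip : ∀ {n} (σ : Permutation′ n) i j → permMat (flip σ) i j ≡ permMat σ j i
permMat-flip σ i j =
  ⌊≟⌋-⇔ (λ e → Inverse.inverseˡ σ (sym e)) (λ e → Inverse.inverseʳ σ (sym e))

toℕ-inject≤-irrelevant : ∀ {m n n'} (k : Fin m) .(p : m ≤ n) .(q : m ≤ n') →
  toℕ (inject≤ k p) ≡ toℕ (inject≤ k q)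
toℕ-inject≤-irrelevant k p q = trans (toℕ-inject≤ k p) (sym (toℕ-inject≤ k q))

permMat-subst : ∀ {a b} (e : a ≡ b) (σ : Permutation′ a) {i j : Fin b} {i' j' : Fin a} →
  toℕ i ≡ toℕ i' → toℕ j ≡ toℕ j' →
  permMat (subst Permutation′ e σ) i j ≡ permMat σ i' j'
permMat-subst refl σ i≡i' j≡j'
  rewrite toℕ-injective i≡i' | toℕ-injective j≡j' = refl

Contains-subst : ∀ {a b} (e : a ≡ b) (σ : Permutation′ a) p →
  Contains (subst Permutation′ e σ) p → Contains σ p
Contains-subst refl σ p contains = contains

Contains-flip : ∀ {N} (σ : Permutation′ N) p →
  Contains σ p → Contains (flip σ) (inversePattern p)
Contains-flip σ (m , π) (f , g , f-mono , g-mono , submatrix) =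
  g , f , g-mono , f-mono , λ i j → begin
    permMat (flip σ) (g i) (f j)  ≡⟨ permMat-flip σ (g i) (f j) ⟩
    permMat σ (f j) (g i)         ≡⟨ submatrix j i ⟩
    permMat π j i                 ≡⟨ permMat-flip π i j ⟨
    permMat (flip π) i j          ∎
  where open ≡-Reasoning

module _ (d c r : ℕ) where

  swapSizes : d + c + r ≡ d + r + c
  swapSizes = begin
    d + c + r    ≡⟨ +-assoc d c r ⟩
    d + (c + r)  ≡⟨ cong (d +_) (+-comm c r) ⟩
    d + (r + c)  ≡⟨ +-assoc d r c ⟨
    d + r + c    ∎
    where open ≡-Reasoning

  inverseExtension : Permutation′ (d + c + r) → Permutation′ (d + r + c)
  inverseExtension σ = subst Permutation′ swapSizes (flip σ)

  Extends-transpose : ∀ σ {ρ : Mat (d + r) (d + c)} →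
    Extends d c r σ ρ → Extends d r c (inverseExtension σ) (transpose ρ)
  Extends-transpose σ {ρ} extends i j = begin
    permMat (inverseExtension σ) (inject≤ i (rows≤ d r c)) (inject≤ j (cols≤ d r c))
      ≡⟨ permMat-subst swapSizes (flip σ)
           (toℕ-inject≤-irrelevant i (rows≤ d r c) (cols≤ d c r))
           (toℕ-inject≤-irrelevant j (cols≤ d r c) (rows≤ d c r)) ⟩
    permMat (flip σ) (inject≤ i (cols≤ d c r)) (inject≤ j (rows≤ d c r))
      ≡⟨ permMat-flip σ _ _ ⟩
    permMat σ (inject≤ j (rows≤ d c r)) (inject≤ i (cols≤ d c r))
      ≡⟨ extends j i ⟩
    ρ j i
      ∎
    where open ≡-Reasoning

  Avoids-inverse : ∀ σ p → Avoids σ p → Avoids (inverseExtension σ) (inversePattern p)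
  Avoids-inverse σ p avoids contains =
    avoids (Contains-flip (flip σ) (inversePattern p)
             (Contains-subst swapSizes (flip σ) (inversePattern p) contains))

  InSAvoid-transpose : ∀ τ {ρ : Mat (d + r) (d + c)} →
    InSAvoid d c r τ ρ → InSAvoid d r c (inversePatterns τ) (transpose ρ)
  InSAvoid-transpose τ (inS , σ , extends , avoidsAll) =
    InS-transpose d c r inS , inverseExtension σ , Extends-transpose σ extends ,
    map⁺ (All.map (λ {p} → Avoids-inverse σ p) avoidsAll)

-- inversePattern is definitionally involutive: flip (flip π) and π agree up to record eta.
InSAvoid-involutive : ∀ d c r τ {ρ : Mat (d + r) (d + c)} →
  InSAvoid d c r (inversePatterns (inversePatterns τ)) ρ → InSAvoid d c r τ ρ
InSAvoid-involutive d c r τ (inS , σ , extends , avoidsAll) =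
  inS , σ , extends , map⁻ (map⁻ avoidsAll)

lemma3p3 : (τ : List Pattern) (d c r : ℕ) →
    SameCard (InSAvoid d c r τ) (InSAvoid d r c (inversePatterns τ))
lemma3p3 τ d c r =
  transpose , transpose ,
  (λ _ → InSAvoid-transpose d c r τ) ,
  (λ _ → InSAvoid-involutive d c r τ ∘′ InSAvoid-transpose d r c (inversePatterns τ)) ,
  (λ _ _ _ _ → refl) , (λ _ _ _ _ → refl)
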